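{- For $A,B\in\mathcal{C}^*_k$, there is an embedding of $A$ into $B$ (as colored graphs) if and only if there is an embedding of $\widehat A$ into $\widehat B$ (as graphs).
   Context: Fix pointed finite graphs $(G_i,a_i)_{i\in\mathbb{N}}$ such that each $G_i$ is 2-connected, $\{G_i\}$ is an antichain under induced embeddability, and no automorphism of any $G_i$ moves $a_i$. Embeddings are induced embeddings (injective maps preserving and reflecting edges, and for colored graphs also preserving and reflecting colors). $\mathcal{C}_k$ is the class of finite graphs with $k$ unary predicates (colors $1,\dots,k$); $\mathcal{C}^*_k$ consists of those in which every vertex has exactly one color and which contain no induced subgraph isomorphic to any $G_i$. For $G\in\mathcal{C}^*_k$, $\widehat G$ is the uncolored graph obtained from $G$ by, for each vertex $v$ of color $i$, taking the disjoint union with a new copy of $G_i$ and identifying $v$ with the basepoint $a_i$ of that copy. -}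

module Defs where

open import Data.Nat using (ℕ; _≥_)
open import Data.Fin using (Fin; toℕ)
open import Data.Bool using (Bool; true)
open import Data.Product using (Σ; Σ-syntax; _×_; _,_; proj₁)
open import Data.Sum using (_⊎_)
open import Relation.Nullary using (¬_)
open import Relation.Binary.PropositionalEquality using (_≡_; _≢_; subst)
open import Function.Bundles using (_⇔_)

record FinGraph : Set where
  field
    n      : ℕ
    adj    : Fin n → Fin n → Bool
    sym    : ∀ x y → adj x y ≡ adj y x
    irrefl : ∀ x → adj x x ≡ Data.Bool.false

open FinGraph public

-- A general relational structure (vertex set + edge relation), used as the
-- common target of embeddings (the graphs Ĝ have a Σ-type as vertex set).
record Structure : Set₁ where
  field
    V : Set
    E : V → V → Set

open Structure public

toStr : FinGraph → Structure
toStr G = record { V = Fin (n G) ; E = λ x y → adj G x y ≡ true }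

record StrEmb (S T : Structure) : Set where
  field
    f     : V S → V T
    inj   : ∀ x y → f x ≡ f y → x ≡ y
    edges : ∀ x y → E S x y ⇔ E T (f x) (f y)

Emb : FinGraph → FinGraph → Set
Emb G H = StrEmb (toStr G) (toStr H)

record Aut (G : FinGraph) : Set where
  field
    emb  : Emb G G
    surj : ∀ y → Σ[ x ∈ Fin (n G) ] StrEmb.f emb x ≡ y

data WalkIn (G : FinGraph) (P : Fin (n G) → Set) : Fin (n G) → Fin (n G) → Set where
  here : ∀ {x} → P x → WalkIn G P x x
  step : ∀ {x z y} → P x → adj G x z ≡ true → WalkIn G P z y → WalkIn G P x y

Connected : FinGraph → Set
Connected G = ∀ x y → WalkIn G (λ _ → Data.Unit.⊤) x y
  where import Data.Unit

ConnectedMinus : (G : FinGraph) → Fin (n G) → Set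
ConnectedMinus G v = ∀ x y → x ≢ v → y ≢ v → WalkIn G (λ u → u ≢ v) x y

TwoConnected : FinGraph → Set
TwoConnected G = (n G ≥ 3) × Connected G × (∀ v → ConnectedMinus G v)

Antichain : (ℕ → FinGraph) → Set
Antichain G = ∀ i j → i ≢ j → ¬ Emb (G i) (G j)

BaseFixed : (G : FinGraph) → Fin (n G) → Set
BaseFixed G a = (φ : Aut G) → StrEmb.f (Aut.emb φ) a ≡ a

-- Color c : Fin k stands for the paper's color toℕ c + 1, and the family
-- is indexed 0-based: G (toℕ c) is the paper's G_{toℕ c + 1}.

record ColGraph (k : ℕ) : Set where
  field
    graph : FinGraph
    col   : Fin (n graph) → Fin k

open ColGraph public

record ColEmb {k : ℕ} (A B : ColGraph k) : Set where
  field
    emb  : Emb (graph A) (graph B)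
    cols : ∀ x → col B (StrEmb.f emb x) ≡ col A x

InCstar : (G : ℕ → FinGraph) {k : ℕ} → ColGraph k → Set
InCstar G A = ∀ i → ¬ Emb (G i) (graph A)

-- Vertices are pairs (v , x) with v a vertex of A and x a
-- vertex of the copy of G_{col v} glued at v; the pair (v , a_{col v}) is
-- the vertex v itself (the identification of v with the basepoint).
-- Edges: edges inside one copy, and edges of A between glued basepoints.

module Hat (G : ℕ → FinGraph) (a : (i : ℕ) → Fin (n (G i))) {k : ℕ} (A : ColGraph k) where

  Gv : Fin (n (graph A)) → FinGraph
  Gv v = G (toℕ (col A v))

  HV : Set
  HV = Σ[ v ∈ Fin (n (graph A)) ] Fin (n (Gv v))

  HE : HV → HV → Set
  HE (v , x) (w , y) =
    (Σ[ p ∈ v ≡ w ] adj (Gv w) (subst (λ u → Fin (n (Gv u))) p x) y ≡ true)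
    ⊎ ((x ≡ a (toℕ (col A v))) × (y ≡ a (toℕ (col A w))) × (adj (graph A) v w ≡ true))

  hatStr : Structure
  hatStr = record { V = HV ; E = HE }

hat : (G : ℕ → FinGraph) (a : (i : ℕ) → Fin (n (G i))) {k : ℕ} → ColGraph k → Structure
hat G a A = Hat.hatStr G a A

-- The colored embedding lifts copy by copy.  Conversely, an embedding φ of Â
-- into B̂ restricts on the copy of G_i glued at v to an embedding of a
-- 2-connected graph.  That copy cannot land entirely on base vertices, since
-- B avoids every G_i; and once one vertex lands inside the copy of G_j at w,
-- the whole copy does, because the only way out of it is through the single
-- base vertex of w, which 2-connectedness lets every path avoid.  The
-- antichain property forces i = j, so the restriction is a self-embedding of
-- the finite graph G_i, hence an automorphism, and fixes a_i: φ sends the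
-- vertex v of Â to the vertex w of B̂, and v ↦ w is the colored embedding.
module Submission where

open import Defs hiding (sym)
open import Data.Nat using (ℕ; suc)
open import Data.Nat.Properties using (n<1+n) renaming (_≟_ to _≟ℕ_)
open import Data.Fin using (Fin; toℕ; punchOut)
open import Data.Fin.Properties
  using (_≟_; any?; all?; ¬∀⟶∃¬; <⇒notInjective; punchOut-injective; toℕ-injective)
open import Data.Bool using (true)
open import Data.Product using (Σ; Σ-syntax; _×_; _,_; proj₁; proj₂)
open import Data.Product.Properties using (,-injectiveʳ-UIP; ≡-dec)
open import Data.Product.Function.NonDependent.Propositional using (_×-⇔_)
open import Data.Sum using (_⊎_; inj₁; inj₂)
open import Data.Empty using (⊥-elim)
open import Relation.Nullary using (¬_; Dec; yes; no)
open import Relation.Binary.PropositionalEquality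
  using (_≡_; _≢_; refl; sym; trans; cong; cong₂; subst)
open import Axiom.UniquenessOfIdentityProofs using (UIP; module Decidable⇒UIP)
open import Function.Bundles using (_⇔_; mk⇔; Equivalence)
open import Function.Construct.Symmetry using (⇔-sym)
open import Function.Construct.Composition using (_⇔-∘_)
open import Function.Related.Propositional using (module EquationalReasoning)

Fin-UIP : ∀ {m} → UIP (Fin m)
Fin-UIP = Decidable⇒UIP.≡-irrelevant _≟_

Fin-injective⇒surjective : ∀ {m} (f : Fin m → Fin m) → (∀ x y → f x ≡ f y → x ≡ y)
                         → ∀ y → Σ[ x ∈ Fin m ] f x ≡ y
Fin-injective⇒surjective {suc m} f f-inj y with any? (λ x → f x ≟ y)
... | yes hit = hit
... | no miss = ⊥-elim (<⇒notInjective {f = missing} (n<1+n m) missing-injective)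
  where
  y≢f : ∀ x → y ≢ f x
  y≢f x y≡fx = miss (x , sym y≡fx)

  missing : Fin (suc m) → Fin m
  missing x = punchOut (y≢f x)

  missing-injective : ∀ {x x'} → missing x ≡ missing x' → x ≡ x'
  missing-injective {x} {x'} eq = f-inj x x' (punchOut-injective (y≢f x) (y≢f x') eq)

no-loop : ∀ H x → adj H x x ≢ true
no-loop H x loop with trans (sym loop) (irrefl H x)
... | ()

_∘ₑ_ : ∀ {R S T} → StrEmb S T → StrEmb R S → StrEmb R T
e ∘ₑ h = record
  { f     = λ r → StrEmb.f e (StrEmb.f h r)
  ; inj   = λ x y eq → StrEmb.inj h x y (StrEmb.inj e _ _ eq)
  ; edges = λ x y → StrEmb.edges e _ _ ⇔-∘ StrEmb.edges h x y
  }

factor : ∀ {R S T} (e : StrEmb S T) (h : StrEmb R T) (g : V R → V S)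
       → (∀ r → StrEmb.f e (g r) ≡ StrEmb.f h r) → StrEmb R S
factor {R} {S} {T} e h g e∘g≡h = record { f = g ; inj = g-injective ; edges = g-edges }
  where
  open EquationalReasoning

  g-injective : ∀ x y → g x ≡ g y → x ≡ y
  g-injective x y eq =
    StrEmb.inj h x y (trans (sym (e∘g≡h x)) (trans (cong (StrEmb.f e) eq) (e∘g≡h y)))

  g-edges : ∀ x y → E R x y ⇔ E S (g x) (g y)
  g-edges x y = begin
    E R x y                                   ∼⟨ StrEmb.edges h x y ⟩
    E T (StrEmb.f h x) (StrEmb.f h y)         ≡⟨ cong₂ (E T) (sym (e∘g≡h x)) (sym (e∘g≡h y)) ⟩
    E T (StrEmb.f e (g x)) (StrEmb.f e (g y)) ∼⟨ ⇔-sym (StrEmb.edges e (g x) (g y)) ⟩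
    E S (g x) (g y)                           ∎

self-embedding⇒automorphism : ∀ {H} → Emb H H → Aut H
self-embedding⇒automorphism ψ =
  record { emb = ψ ; surj = Fin-injective⇒surjective (StrEmb.f ψ) (StrEmb.inj ψ) }

module _ (G : ℕ → FinGraph) (a : (i : ℕ) → Fin (n (G i))) where

  module _ {k : ℕ} (X : ColGraph k) where
    open Hat G a X

    base : (v : Fin (n (graph X))) → Fin (n (Gv v))
    base v = a (toℕ (col X v))

    copyBase : HV → HV
    copyBase (v , _) = v , base v

    IsBase : HV → Set
    IsBase q = q ≡ copyBase q

    isBase? : ∀ q → Dec (IsBase q)
    isBase? q = ≡-dec _≟_ _≟_ q (copyBase q)

    copy-coordinate : ∀ {w} (q : HV) → proj₁ q ≡ w → Σ[ y ∈ Fin (n (Gv w)) ] q ≡ (w , y)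
    copy-coordinate (v , y) refl = y , refl

    edge-inside-copy : ∀ v x y → HE (v , x) (v , y) ⇔ (adj (Gv v) x y ≡ true)
    edge-inside-copy v x y = mk⇔ to (λ xy → inj₁ (refl , xy))
      where
      to : HE (v , x) (v , y) → adj (Gv v) x y ≡ true
      to (inj₁ (v≡v , xy)) rewrite Fin-UIP v≡v refl = xy
      to (inj₂ (_ , _ , vv)) = ⊥-elim (no-loop (graph X) v vv)

    edge-between-bases : ∀ v w → HE (v , base v) (w , base w) ⇔ (adj (graph X) v w ≡ true)
    edge-between-bases v w = mk⇔ to (λ vw → inj₂ (refl , refl , vw))
      where
      to : HE (v , base v) (w , base w) → adj (graph X) v w ≡ true
      to (inj₁ (refl , loop)) = ⊥-elim (no-loop (Gv v) (base v) loop)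
      to (inj₂ (_ , _ , vw)) = vw

    edge-between-copies : ∀ {v w} x y → v ≢ w
      → HE (v , x) (w , y) ⇔ ((x ≡ base v) × (y ≡ base w) × (adj (graph X) v w ≡ true))
    edge-between-copies x y v≢w = mk⇔ to inj₂
      where
      to : HE _ _ → _
      to (inj₁ (v≡w , _)) = ⊥-elim (v≢w v≡w)
      to (inj₂ bases-adjacent) = bases-adjacent

    copyEmb : ∀ v → StrEmb (toStr (Gv v)) hatStr
    copyEmb v = record
      { f     = v ,_
      ; inj   = λ x y eq → ,-injectiveʳ-UIP Fin-UIP eq
      ; edges = λ x y → ⇔-sym (edge-inside-copy v x y)
      }

    baseEmb : StrEmb (toStr (graph X)) hatStr
    baseEmb = record
      { f     = λ v → v , base v
      ; inj   = λ v w eq → cong proj₁ eq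
      ; edges = λ v w → ⇔-sym (edge-between-bases v w)
      }

    edge-stays-in-copy : ∀ {w} q q' → HE q q' → proj₁ q ≡ w → q ≢ (w , base w) → proj₁ q' ≡ w
    edge-stays-in-copy _ _ (inj₁ (v≡v' , _)) refl _ = sym v≡v'
    edge-stays-in-copy (v , _) _ (inj₂ (x≡base , _)) refl q≢base = ⊥-elim (q≢base (cong (v ,_) x≡base))

    walk-stays-in-copy : ∀ {H} (h : StrEmb (toStr H) hatStr) {w P}
      → (∀ u → P u → StrEmb.f h u ≢ (w , base w))
      → ∀ {x y} → WalkIn H P x y → proj₁ (StrEmb.f h x) ≡ w → proj₁ (StrEmb.f h y) ≡ w
    walk-stays-in-copy h avoids (here _) inside = inside
    walk-stays-in-copy h avoids (step {x} {z} px xz walk) inside =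
      walk-stays-in-copy h avoids walk
        (edge-stays-in-copy _ _ (Equivalence.to (StrEmb.edges h x z) xz) inside (avoids x px))

    -- When the base vertex of the copy is hit, at b say, walks in H - b avoid it.
    copy-confined : ∀ {H} → TwoConnected H → (h : StrEmb (toStr H) hatStr)
      → ∀ x₀ → ¬ IsBase (StrEmb.f h x₀) → ∀ x → proj₁ (StrEmb.f h x) ≡ proj₁ (StrEmb.f h x₀)
    copy-confined (_ , connected , connected-minus) h x₀ x₀-inner x
      with any? (λ b → ≡-dec _≟_ _≟_ (StrEmb.f h b) (copyBase (StrEmb.f h x₀)))
    ... | no unhit = walk-stays-in-copy h (λ u _ hits → unhit (u , hits)) (connected x₀ x) refl
    ... | yes (b , b-hits) with x ≟ b
    ...   | yes refl = cong proj₁ b-hits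
    ...   | no x≢b = walk-stays-in-copy h
                       (λ u u≢b hits → u≢b (StrEmb.inj h u b (trans hits (sym b-hits))))
                       (connected-minus b x₀ x (λ { refl → x₀-inner b-hits }) x≢b) refl

    embedding-into-copy : ∀ {H} (h : StrEmb (toStr H) hatStr) w → (∀ x → proj₁ (StrEmb.f h x) ≡ w)
      → Σ[ ψ ∈ Emb H (Gv w) ] ∀ x → StrEmb.f h x ≡ (w , StrEmb.f ψ x)
    embedding-into-copy h w inside =
      factor (copyEmb w) h (λ x → proj₁ (coordinate x)) (λ x → sym (proj₂ (coordinate x))) ,
      λ x → proj₂ (coordinate x)
      where
      coordinate : ∀ x → Σ[ y ∈ Fin (n (Gv w)) ] StrEmb.f h x ≡ (w , y)
      coordinate x = copy-coordinate (StrEmb.f h x) (inside x)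

    copy-or-base : ∀ {H} → TwoConnected H → (h : StrEmb (toStr H) hatStr)
      → Emb H (graph X)
        ⊎ Σ[ w ∈ Fin (n (graph X)) ] Σ[ ψ ∈ Emb H (Gv w) ] ∀ x → StrEmb.f h x ≡ (w , StrEmb.f ψ x)
    copy-or-base {H} H-2conn h with all? (λ x → isBase? (StrEmb.f h x))
    ... | yes all-base =
      inj₁ (factor baseEmb h (λ x → proj₁ (StrEmb.f h x)) (λ x → sym (all-base x)))
    ... | no ¬all-base with ¬∀⟶∃¬ (n H) (λ x → IsBase (StrEmb.f h x)) (λ x → isBase? (StrEmb.f h x)) ¬all-base
    ...   | x₀ , x₀-inner =
      inj₂ (w , embedding-into-copy {H} h w (copy-confined H-2conn h x₀ x₀-inner))
      where w = proj₁ (StrEmb.f h x₀)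

  recolor : ∀ {k} {c c' : Fin k} → c ≡ c' → Fin (n (G (toℕ c))) → Fin (n (G (toℕ c')))
  recolor = subst (λ c → Fin (n (G (toℕ c))))

  recolor-injective : ∀ {k} {c c' : Fin k} (p : c ≡ c') {x y} → recolor p x ≡ recolor p y → x ≡ y
  recolor-injective refl eq = eq

  recolor-adj : ∀ {k} {c c' : Fin k} (p : c ≡ c') x y
    → (adj (G (toℕ c)) x y ≡ true) ⇔ (adj (G (toℕ c')) (recolor p x) (recolor p y) ≡ true)
  recolor-adj refl x y = mk⇔ (λ xy → xy) (λ xy → xy)

  recolor-base : ∀ {k} {c c' : Fin k} (p : c ≡ c') x → (x ≡ a (toℕ c)) ⇔ (recolor p x ≡ a (toℕ c'))
  recolor-base refl x = mk⇔ (λ eq → eq) (λ eq → eq)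

  module _ {k : ℕ} {A B : ColGraph k} (θ : ColEmb A B) where
    private
      θ₀ = ColEmb.emb θ
      θ₀-colors = ColEmb.cols θ

    lift : Hat.HV G a A → Hat.HV G a B
    lift (v , x) = StrEmb.f θ₀ v , recolor (sym (θ₀-colors v)) x

    lift-injective : ∀ p q → lift p ≡ lift q → p ≡ q
    lift-injective (v , x) (v' , x') eq with StrEmb.inj θ₀ v v' (cong proj₁ eq)
    ... | refl = cong (v ,_) (recolor-injective (sym (θ₀-colors v)) (,-injectiveʳ-UIP Fin-UIP eq))

    lift-edges : ∀ p q → Hat.HE G a A p q ⇔ Hat.HE G a B (lift p) (lift q)
    lift-edges (v , x) (v' , x') with v ≟ v'
    ... | yes refl =
      ⇔-sym (edge-inside-copy B _ _ _)
      ⇔-∘ (recolor-adj (sym (θ₀-colors v)) x x' ⇔-∘ edge-inside-copy A v x x')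
    ... | no v≢v' =
      ⇔-sym (edge-between-copies B _ _ (λ eq → v≢v' (StrEmb.inj θ₀ v v' eq)))
      ⇔-∘ ((recolor-base (sym (θ₀-colors v)) x ×-⇔ recolor-base (sym (θ₀-colors v')) x'
             ×-⇔ StrEmb.edges θ₀ v v')
           ⇔-∘ edge-between-copies A x x' v≢v')

    liftEmb : StrEmb (hat G a A) (hat G a B)
    liftEmb = record { f = lift ; inj = lift-injective ; edges = lift-edges }

  module _ (anti : Antichain G) (base-fixed : ∀ i → BaseFixed (G i) (a i)) where

    embedding-fixes-base : ∀ {i j} (ψ : Emb (G i) (G j)) → Σ (i ≡ j) λ _ → StrEmb.f ψ (a i) ≡ a j
    embedding-fixes-base {i} {j} ψ with i ≟ℕ j
    ... | no i≢j = ⊥-elim (anti i j i≢j ψ)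
    ... | yes refl = refl , base-fixed i (self-embedding⇒automorphism ψ)

    module _ (2conn : ∀ i → TwoConnected (G i)) {k : ℕ} {A B : ColGraph k} (B∈C* : InCstar G B)
             (φ : StrEmb (hat G a A) (hat G a B)) where

      base-image : ∀ v → Σ[ w ∈ Fin (n (graph B)) ]
        (col B w ≡ col A v) × (StrEmb.f φ (v , base A v) ≡ (w , base B w))
      base-image v with copy-or-base B (2conn _) (φ ∘ₑ copyEmb A v)
      ... | inj₁ into-B = ⊥-elim (B∈C* _ into-B)
      ... | inj₂ (w , ψ , φ≡ψ) with embedding-fixes-base ψ
      ...   | i≡j , ψ-fixes = w , toℕ-injective (sym i≡j) , trans (φ≡ψ _) (cong (w ,_) ψ-fixes)

      descendEmb : ColEmb A B
      descendEmb = record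
        { emb  = factor (baseEmb B) (φ ∘ₑ baseEmb A) (λ v → proj₁ (base-image v))
                   (λ v → sym (proj₂ (proj₂ (base-image v))))
        ; cols = λ v → proj₁ (proj₂ (base-image v))
        }

lemma4p10 : (k : ℕ) (G : ℕ → FinGraph) (a : (i : ℕ) → Fin (n (G i)))
            → (∀ i → TwoConnected (G i))
            → Antichain G
            → (∀ i → BaseFixed (G i) (a i))
            → (A B : ColGraph k) → InCstar G A → InCstar G B
            → ColEmb A B ⇔ StrEmb (hat G a A) (hat G a B)
lemma4p10 k G a 2conn anti base-fixed A B _ B∈C* =
  mk⇔ (liftEmb G a) (descendEmb G a anti base-fixed 2conn B∈C*)
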